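{- Let $\Pi$ be a projective plane of order $p^2$, $p\geq 3$ prime, and let $c\in\mathrm{C}(\Pi)^\perp$ have weight $2p^2-2p+2+\epsilon$ with $1\leq\epsilon\leq p-2$. Then the number of distinct non-zero symbols occurring in $c$ is even.
   Context: $\mathrm{C}(\Pi)$ is the $\mathbb{F}_p$-span of the incidence vectors of the lines of $\Pi$, viewed as vectors indexed by points; $\mathrm{C}(\Pi)^\perp$ is the set of vectors $v$ with $\sum_{P\in\ell}v_P=0$ in $\mathbb{F}_p$ for every line $\ell$. The weight is the number of non-zero positions. -}

module Defs where

open import Data.Nat using (ℕ; zero; suc; _+_; _*_)
open import Data.Nat.Divisibility using (_∣_)
open import Data.Bool using (Bool; true; false; if_then_else_; _∧_; not)
open import Data.Fin using (Fin; toℕ) renaming (zero to fz; suc to fs)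
open import Data.Product using (Σ; _×_; ∃)
open import Relation.Binary.PropositionalEquality using (_≡_; _≢_)
open import Relation.Nullary using (¬_; does)
open import Data.Nat.Primality using (Prime)
import Data.Fin as F
import Data.Nat as N

count : ∀ {n} → (Fin n → Bool) → ℕ
count {zero} f = 0
count {suc n} f = (if f fz then 1 else 0) + count (λ i → f (fs i))

sumF : ∀ {n} → (Fin n → ℕ) → ℕ
sumF {zero} f = 0
sumF {suc n} f = f fz + sumF (λ i → f (fs i))

-- An incidence structure with points Fin v, lines Fin b,
-- and incidence I P l = true iff point P lies on line l.
record ProjectivePlane (n : ℕ) : Set where
  field
    v b : ℕ
    I : Fin v → Fin b → Bool
    twoPoints : ∀ (P Q : Fin v) → P ≢ Q → count (λ l → I P l ∧ I Q l) ≡ 1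
    twoLines : ∀ (l m : Fin b) → l ≢ m → count (λ P → I P l ∧ I P m) ≡ 1
    quadrangle : Σ (Fin v) λ A → Σ (Fin v) λ B → Σ (Fin v) λ C → Σ (Fin v) λ D →
      (A ≢ B × A ≢ C × A ≢ D × B ≢ C × B ≢ D × C ≢ D) ×
      (∀ (l : Fin b) →
         ¬ (I A l ≡ true × I B l ≡ true × I C l ≡ true) ×
         ¬ (I A l ≡ true × I B l ≡ true × I D l ≡ true) ×
         ¬ (I A l ≡ true × I C l ≡ true × I D l ≡ true) ×
         ¬ (I B l ≡ true × I C l ≡ true × I D l ≡ true))
    order : ∀ (l : Fin b) → count (λ P → I P l) ≡ suc n

open ProjectivePlane public

-- Words over F_p indexed by the points: F_p is represented by Fin p,
-- with arithmetic modulo p (only addition is needed, via toℕ and divisibility).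
Word : ∀ {n} → ProjectivePlane n → ℕ → Set
Word Π p = Fin (v Π) → Fin p

isZero : ∀ {p} → Fin p → Bool
isZero s = does (toℕ s N.≟ 0)

-- c ∈ C(Π)^⊥ : for every line l, the sum over P ∈ l of c_P is 0 in F_p
InDualCode : ∀ {n} (Π : ProjectivePlane n) (p : ℕ) → Word Π p → Set
InDualCode Π p c = ∀ (l : Fin (b Π)) →
  p ∣ sumF (λ P → if I Π P l then toℕ (c P) else 0)

weight : ∀ {n} {Π : ProjectivePlane n} {p} → Word Π p → ℕ
weight c = count (λ P → not (isZero (c P)))

occurs : ∀ {n} {Π : ProjectivePlane n} {p} → Word Π p → Fin p → Bool
occurs c s = not (does (count (λ P → does (c P F.≟ s)) N.≟ 0))

nSymbols : ∀ {n} {Π : ProjectivePlane n} {p} → Word Π p → ℕ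
nSymbols {Π = Π} {p = p} c = count (λ (s : Fin p) → not (isZero s) ∧ occurs {Π = Π} c s)

{-# OPTIONS --safe #-}
-- Let c ∈ C(Π)^⊥ have weight at most 2(q + 1), q the order of Π, and let P be in its support.
-- No line through P meets the support in P alone, as its line sum would be c_P ≢ 0 (mod p).
-- If no line through P met the support in exactly one further point, each of the q + 1 lines
-- through P would carry two further support points, and the weight would exceed 2(q + 1).
-- So some line meets the support in exactly {P, Q}, and then c_Q = −c_P. Hence the non-zero
-- symbols of c are closed under s ↦ −s, a fixed-point-free involution for odd p, so they
-- come in pairs.
module Submission where

open import Defs
open import Data.Nat using (ℕ; zero; suc; _+_; _*_; _∸_; _≤_; _<_; z≤n; s≤s)
open import Data.Nat.Divisibility using (_∣_; divides)
open import Data.Nat.Primality using (Prime; prime⇒irreducible)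
open import Data.Sum using (inj₁; inj₂)
open import Data.Nat.Properties
  using ( +-0-commutativeMonoid; +-identityʳ; +-comm; +-assoc; +-suc; +-cancelˡ-≡; *-zeroʳ; *-identityʳ
        ; *-distribˡ-+; *-suc; *-comm; suc-injective; 1+n≢0; n≢0⇒n>0; ≤-refl; ≤-trans; ≤-pred; <⇒≤
        ; <⇒≢; <⇒≱; <-≤-trans; n≤0⇒n≡0; m≤m+n; m≤m*n; m∸n≤m; m∸n+n≡m; m+[n∸m]≡n; +-mono-≤
        ; +-monoʳ-≤; +-mono-<; *-monoʳ-≤; module ≤-Reasoning)
open import Data.Bool using (Bool; true; false; if_then_else_; _∧_; not)
open import Data.Bool.Properties as Boolₚ using (∧-identityʳ; ∧-zeroʳ; ∧-conicalˡ; ∧-conicalʳ; ¬-not)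
open import Data.Fin using (Fin; zero; suc; toℕ; opposite; _≟_)
open import Data.Product using (∃; _×_; _,_; proj₁; proj₂)
open import Data.Empty using (⊥-elim)
open import Function using (_∘_)
import Data.Fin.Properties as Finₚ
open import Relation.Binary.PropositionalEquality
open import Relation.Nullary using (¬_; Dec; does; yes; no)
open import Relation.Nullary.Decidable using (dec-true; dec-false; _×-dec_)
import Data.Nat as ℕ
open import Algebra.Properties.CommutativeMonoid.Sum +-0-commutativeMonoid using (sum; ∑-comm)

does≡true⇒ : ∀ {A : Set} (d : Dec A) → does d ≡ true → A
does≡true⇒ (yes a) _ = a

not-does≡true⇒¬ : ∀ {A : Set} (d : Dec A) → not (does d) ≡ true → ¬ A
not-does≡true⇒¬ (no ¬a) _ = ¬a

not-does≡false⇒ : ∀ {A : Set} (d : Dec A) → not (does d) ≡ false → A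
not-does≡false⇒ (yes a) _ = a

¬⇒not-does≡true : ∀ {A : Set} (d : Dec A) → ¬ A → not (does d) ≡ true
¬⇒not-does≡true d ¬a = cong not (dec-false d ¬a)

n∣m⇒m≡n : ∀ {m n} → 0 < m → m < n + n → n ∣ m → m ≡ n
n∣m⇒m≡n {n = n} ()  _   (divides zero refl)
n∣m⇒m≡n {n = n} _   _   (divides (suc zero) refl) = +-identityʳ n
n∣m⇒m≡n {n = n} _   m<2n (divides (suc (suc k)) refl) =
  ⊥-elim (<⇒≱ m<2n (+-monoʳ-≤ n (m≤m+n n (k * n))))

𝟙 : Bool → ℕ
𝟙 b = if b then 1 else 0

sumF-cong : ∀ {m} {f g : Fin m → ℕ} → (∀ i → f i ≡ g i) → sumF f ≡ sumF g
sumF-cong {zero}  f≗g = refl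
sumF-cong {suc m} f≗g = cong₂ _+_ (f≗g zero) (sumF-cong (f≗g ∘ suc))

sumF≡sum : ∀ {m} (f : Fin m → ℕ) → sumF f ≡ sum f
sumF≡sum {zero}  f = refl
sumF≡sum {suc m} f = cong (f zero +_) (sumF≡sum (f ∘ suc))

sumF-comm : ∀ {m k} (g : Fin m → Fin k → ℕ) →
  sumF (λ i → sumF (λ j → g i j)) ≡ sumF (λ j → sumF (λ i → g i j))
sumF-comm g = begin
  sumF (λ i → sumF (λ j → g i j)) ≡⟨ sumF-cong (λ i → sumF≡sum (g i)) ⟩
  sumF (λ i → sum (λ j → g i j))  ≡⟨ sumF≡sum (λ i → sum (g i)) ⟩
  sum (λ i → sum (λ j → g i j))   ≡⟨ ∑-comm g ⟩
  sum (λ j → sum (λ i → g i j))   ≡⟨ sumF≡sum (λ j → sum (λ i → g i j)) ⟨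
  sumF (λ j → sum (λ i → g i j))  ≡⟨ sumF-cong (λ j → sumF≡sum (λ i → g i j)) ⟨
  sumF (λ j → sumF (λ i → g i j)) ∎
  where open ≡-Reasoning

sumF-zero : ∀ {m} {f : Fin m → ℕ} → (∀ i → f i ≡ 0) → sumF f ≡ 0
sumF-zero {zero}  f≗0 = refl
sumF-zero {suc m} f≗0 = cong₂ _+_ (f≗0 zero) (sumF-zero (f≗0 ∘ suc))

sumF-mono : ∀ {m} {f g : Fin m → ℕ} → (∀ i → f i ≤ g i) → sumF f ≤ sumF g
sumF-mono {zero}  f≤g = z≤n
sumF-mono {suc m} f≤g = +-mono-≤ (f≤g zero) (sumF-mono (f≤g ∘ suc))

sumF-single : ∀ {m} (f : Fin m → ℕ) (i : Fin m) → (∀ j → j ≢ i → f j ≡ 0) → sumF f ≡ f i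
sumF-single f zero    f≗0 = trans (cong (f zero +_) (sumF-zero λ j → f≗0 (suc j) λ ())) (+-identityʳ _)
sumF-single f (suc i) f≗0 = cong₂ _+_ (f≗0 zero λ ())
  (sumF-single (f ∘ suc) i λ j j≢i → f≗0 (suc j) (j≢i ∘ Finₚ.suc-injective))

sumF-pair : ∀ {m} (f : Fin m → ℕ) {i j : Fin m} → i ≢ j → (∀ k → k ≢ i → k ≢ j → f k ≡ 0) →
            sumF f ≡ f i + f j
sumF-pair f {zero}  {zero}  i≢j _   = ⊥-elim (i≢j refl)
sumF-pair f {zero}  {suc j} _   f≗0 = cong (f zero +_)
  (sumF-single (f ∘ suc) j λ k k≢j → f≗0 (suc k) (λ ()) (k≢j ∘ Finₚ.suc-injective))
sumF-pair f {suc i} {zero}  _   f≗0 = trans (cong (f zero +_)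
  (sumF-single (f ∘ suc) i λ k k≢i → f≗0 (suc k) (k≢i ∘ Finₚ.suc-injective) (λ ())))
  (+-comm (f zero) _)
sumF-pair f {suc i} {suc j} i≢j f≗0 = cong₂ _+_ (f≗0 zero (λ ()) (λ ()))
  (sumF-pair (f ∘ suc) (i≢j ∘ cong suc) λ k k≢i k≢j →
    f≗0 (suc k) (k≢i ∘ Finₚ.suc-injective) (k≢j ∘ Finₚ.suc-injective))

sumF-if : ∀ {m} (k : ℕ) (f : Fin m → Bool) → sumF (λ i → if f i then k else 0) ≡ k * count f
sumF-if {zero}  k f = sym (*-zeroʳ k)
sumF-if {suc m} k f =
  trans (cong₂ _+_ (summand (f zero)) (sumF-if k (f ∘ suc))) (sym (*-distribˡ-+ k _ _))
  where
  summand : ∀ b → (if b then k else 0) ≡ k * 𝟙 b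
  summand true  = sym (*-identityʳ k)
  summand false = sym (*-zeroʳ k)

count≡sumF𝟙 : ∀ {m} (f : Fin m → Bool) → count f ≡ sumF (λ i → 𝟙 (f i))
count≡sumF𝟙 {zero}  f = refl
count≡sumF𝟙 {suc m} f = cong (𝟙 (f zero) +_) (count≡sumF𝟙 (f ∘ suc))

count-cong : ∀ {m} {f g : Fin m → Bool} → (∀ i → f i ≡ g i) → count f ≡ count g
count-cong {f = f} {g} f≗g =
  trans (count≡sumF𝟙 f) (trans (sumF-cong (cong 𝟙 ∘ f≗g)) (sym (count≡sumF𝟙 g)))

count≡0⇒false : ∀ {m} {f : Fin m → Bool} → count f ≡ 0 → ∀ i → f i ≡ false
count≡0⇒false {suc m} {f} c≡0 i with f zero in f₀
count≡0⇒false {suc m} {f} () i        | true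
count≡0⇒false {suc m} {f} c≡0 zero    | false = f₀
count≡0⇒false {suc m} {f} c≡0 (suc i) | false = count≡0⇒false {f = f ∘ suc} c≡0 i

true⇒count≢0 : ∀ {m} {f : Fin m → Bool} {i : Fin m} → f i ≡ true → count f ≢ 0
true⇒count≢0 {i = i} fi c≡0 with () ← trans (sym fi) (count≡0⇒false c≡0 i)

count≢0⇒∃ : ∀ {m} (f : Fin m → Bool) → count f ≢ 0 → ∃ λ i → f i ≡ true
count≢0⇒∃ {zero}  f c≢0 = ⊥-elim (c≢0 refl)
count≢0⇒∃ {suc m} f c≢0 with f zero in f₀
... | true  = zero , f₀
... | false with count≢0⇒∃ (f ∘ suc) c≢0
...   | i , fi = suc i , fi

infixl 6 _∖_

_∖_ : ∀ {m} → (Fin m → Bool) → Fin m → Fin m → Bool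
(f ∖ i) j = f j ∧ not (does (j ≟ i))

∖-intro : ∀ {m} {f : Fin m → Bool} {i j : Fin m} → f j ≡ true → j ≢ i → (f ∖ i) j ≡ true
∖-intro {f = f} {i} {j} fj j≢i rewrite dec-false (j ≟ i) j≢i = trans (∧-identityʳ (f j)) fj

∖-elim : ∀ {m} {f : Fin m → Bool} {i j : Fin m} → (f ∖ i) j ≡ true → f j ≡ true × j ≢ i
∖-elim {f = f} {i} {j} h with f j | j ≟ i
∖-elim () | false | _
∖-elim () | true  | yes _
∖-elim _  | true  | no j≢i = refl , j≢i

∖-≢ : ∀ {m} (f : Fin m → Bool) {i j : Fin m} → j ≢ i → (f ∖ i) j ≡ f j
∖-≢ f {i} {j} j≢i rewrite dec-false (j ≟ i) j≢i = ∧-identityʳ (f j)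

count-∖ : ∀ {m} (f : Fin m → Bool) {i : Fin m} → f i ≡ true → count f ≡ suc (count (f ∖ i))
count-∖ {suc m} f {zero} f₀ rewrite f₀ = cong suc (count-cong λ j → sym (∖-≢ f {zero} {suc j} λ ()))
count-∖ {suc m} f {suc i} fi rewrite ∧-identityʳ (f zero) with f zero
... | true  = cong suc (count-∖ (f ∘ suc) fi)
... | false = count-∖ (f ∘ suc) fi

count≡1⇒unique : ∀ {m} {f : Fin m → Bool} → count f ≡ 1 → ∀ {i j} → f i ≡ true → f j ≡ true → j ≡ i
count≡1⇒unique {f = f} c≡1 {i} {j} fi fj with j ≟ i
... | yes j≡i = j≡i
... | no  j≢i with () ← trans (sym (∖-intro {f = f} fj j≢i))
                             (count≡0⇒false (suc-injective (trans (sym (count-∖ f fi)) c≡1)) j)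

record FreeInvolutionOn {m} (σ : Fin m → Fin m) (f : Fin m → Bool) : Set where
  field
    closed       : ∀ {i} → f i ≡ true → f (σ i) ≡ true
    fixpointFree : ∀ {i} → f i ≡ true → σ i ≢ i
    involutive   : ∀ {i} → f i ≡ true → σ (σ i) ≡ i

module _ {m} {σ : Fin m → Fin m} {f : Fin m → Bool} (inv : FreeInvolutionOn σ f)
         {i : Fin m} (fi : f i ≡ true) where
  open FreeInvolutionOn inv

  count-∖-orbit : count f ≡ 2 + count (f ∖ i ∖ σ i)
  count-∖-orbit =
    trans (count-∖ f fi) (cong suc (count-∖ (f ∖ i) (∖-intro {f = f} (closed fi) (fixpointFree fi))))

  ∖-orbit : FreeInvolutionOn σ (f ∖ i ∖ σ i)
  ∖-orbit = record
    { closed       = λ {j} h → let fj , j≢i , j≢σi = elim h in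
                       ∖-intro {f = f ∖ i} (∖-intro {f = f} (closed fj)
                         (λ σj≡i → j≢σi (trans (sym (involutive fj)) (cong σ σj≡i))))
                         (λ σj≡σi → j≢i (trans (sym (involutive fj)) (trans (cong σ σj≡σi) (involutive fi))))
    ; fixpointFree = λ h → fixpointFree (proj₁ (elim h))
    ; involutive   = λ h → involutive (proj₁ (elim h))
    }
    where
    elim : ∀ {j} → (f ∖ i ∖ σ i) j ≡ true → f j ≡ true × j ≢ i × j ≢ σ i
    elim h = let h′ , j≢σi = ∖-elim {f = f ∖ i} h ; fj , j≢i = ∖-elim {f = f} h′ in fj , j≢i , j≢σi

count-even : ∀ {m} {σ : Fin m → Fin m} {f : Fin m → Bool} → FreeInvolutionOn σ f →
             ∃ λ k → count f ≡ 2 * k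
count-even {σ = σ} {f} inv = go (count f) f ≤-refl inv
  where
  go : ∀ fuel g → count g ≤ fuel → FreeInvolutionOn σ g → ∃ λ k → count g ≡ 2 * k
  go zero g c≤0 _ = 0 , n≤0⇒n≡0 c≤0
  go (suc fuel) g c≤fuel inv with count g ℕ.≟ 0
  ... | yes c≡0 = 0 , c≡0
  ... | no  c≢0 with count≢0⇒∃ g c≢0
  ...   | i , gi with go fuel (g ∖ i ∖ σ i)
                          (<⇒≤ (≤-pred (subst (_≤ suc fuel) (count-∖-orbit inv gi) c≤fuel)))
                          (∖-orbit inv gi)
  ...     | k , c′≡2k = suc k , trans (count-∖-orbit inv gi) (trans (cong (2 +_) c′≡2k) (sym (*-suc 2 k)))

neg : ∀ {p} → Fin p → Fin p
neg zero    = zero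
neg (suc i) = suc (opposite i)

neg-involutive : ∀ {p} (s : Fin p) → neg (neg s) ≡ s
neg-involutive zero    = refl
neg-involutive (suc i) = cong suc (Finₚ.opposite-involutive i)

toℕ-neg≢0 : ∀ {p} (s : Fin p) → toℕ s ≢ 0 → toℕ (neg s) ≢ 0
toℕ-neg≢0 zero    s≢0 = s≢0
toℕ-neg≢0 (suc i) _   = λ ()

toℕ+toℕ-neg : ∀ {p} (s : Fin p) → toℕ s ≢ 0 → toℕ s + toℕ (neg s) ≡ p
toℕ+toℕ-neg zero s≢0 = ⊥-elim (s≢0 refl)
toℕ+toℕ-neg {suc k} (suc i) _ = cong suc (begin
  toℕ i + suc (toℕ (opposite i))    ≡⟨ +-suc (toℕ i) _ ⟩
  suc (toℕ i + toℕ (opposite i))    ≡⟨ cong (λ x → suc (toℕ i + x)) (Finₚ.opposite-prop i) ⟩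
  suc (toℕ i) + (k ∸ suc (toℕ i))   ≡⟨ m+[n∸m]≡n (Finₚ.toℕ<n i) ⟩
  k                                 ∎)
  where open ≡-Reasoning

toℕ+toℕ≡p⇒neg : ∀ {p} (s t : Fin p) → toℕ s + toℕ t ≡ p → t ≡ neg s
toℕ+toℕ≡p⇒neg zero    t t≡p = ⊥-elim (<⇒≢ (Finₚ.toℕ<n t) t≡p)
toℕ+toℕ≡p⇒neg (suc i) t s+t≡p =
  Finₚ.toℕ-injective (+-cancelˡ-≡ (toℕ (suc i)) _ _ (trans s+t≡p (sym (toℕ+toℕ-neg (suc i) λ ()))))

neg-fixpointFree : ∀ {p} → ¬ 2 ∣ p → (s : Fin p) → toℕ s ≢ 0 → neg s ≢ s
neg-fixpointFree {p} p-odd s s≢0 neg-s≡s = p-odd (divides (toℕ s) (begin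
  p                   ≡⟨ toℕ+toℕ-neg s s≢0 ⟨
  toℕ s + toℕ (neg s) ≡⟨ cong (λ t → toℕ s + toℕ t) neg-s≡s ⟩
  toℕ s + toℕ s       ≡⟨ cong (toℕ s +_) (+-identityʳ (toℕ s)) ⟨
  2 * toℕ s           ≡⟨ *-comm 2 (toℕ s) ⟩
  toℕ s * 2           ∎))
  where open ≡-Reasoning

prime⇒odd : ∀ {p} → Prime p → 3 ≤ p → ¬ 2 ∣ p
prime⇒odd pr 3≤p 2∣p with prime⇒irreducible pr 2∣p
... | inj₁ ()
... | inj₂ refl with s≤s (s≤s ()) ← 3≤p

module _ {n} (Π : ProjectivePlane n) where

  pointsOn : Fin (b Π) → (Fin (v Π) → Bool) → ℕ
  pointsOn l T = count (λ Q → I Π Q l ∧ T Q)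

  linesThrough : Fin (v Π) → ℕ
  linesThrough P = count (I Π P)

  sumThrough : Fin (v Π) → (Fin (b Π) → ℕ) → ℕ
  sumThrough P f = sumF (λ l → if I Π P l then f l else 0)

  sumThrough-mono : ∀ P {f g : Fin (b Π) → ℕ} → (∀ {l} → I Π P l ≡ true → f l ≤ g l) →
                    sumThrough P f ≤ sumThrough P g
  sumThrough-mono P f≤g = sumF-mono pointwise
    where
    pointwise : ∀ l → (if I Π P l then _ else 0) ≤ (if I Π P l then _ else 0)
    pointwise l with I Π P l in Pl
    ... | true  = f≤g Pl
    ... | false = z≤n

  lineThrough : ∀ {P Q} → P ≢ Q → ∃ λ l → I Π P l ≡ true × I Π Q l ≡ true
  lineThrough {P} {Q} P≢Q with count≢0⇒∃ _ (λ c≡0 → 1+n≢0 (trans (sym (twoPoints Π P Q P≢Q)) c≡0))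
  ... | l , PQl = l , ∧-conicalˡ _ _ PQl , ∧-conicalʳ (I Π P l) _ PQl

  lineThrough-unique : ∀ {P Q} → P ≢ Q → ∀ {l l′} → I Π P l ≡ true → I Π Q l ≡ true →
                       I Π P l′ ≡ true → I Π Q l′ ≡ true → l′ ≡ l
  lineThrough-unique {P} {Q} P≢Q Pl Ql Pl′ Ql′ =
    count≡1⇒unique (twoPoints Π P Q P≢Q) (cong₂ _∧_ Pl Ql) (cong₂ _∧_ Pl′ Ql′)

  lineAvoiding : ∀ P → ∃ λ l → I Π P l ≡ false
  lineAvoiding P with quadrangle Π
  ... | A , B , C , _ , (A≢B , A≢C , _ , B≢C , _) , noThree with P Finₚ.≟ A
  ...   | yes refl = let l , Bl , Cl = lineThrough B≢C in
                     l , ¬-not (λ Pl → proj₁ (noThree l) (Pl , Bl , Cl))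
  ...   | no  P≢A with lineThrough A≢B | lineThrough A≢C
  ...     | l₁ , Al₁ , Bl₁ | l₂ , Al₂ , Cl₂ with I Π P l₁ in Pl₁ | I Π P l₂ in Pl₂
  ...       | false | _     = l₁ , Pl₁
  ...       | true  | false = l₂ , Pl₂
  ...       | true  | true  = ⊥-elim (proj₁ (noThree l₁) (Al₁ , Bl₁ , Cl₁))
    where
    Cl₁ : I Π C l₁ ≡ true
    Cl₁ = subst (λ l → I Π C l ≡ true) (lineThrough-unique (P≢A ∘ sym) Al₁ Pl₁ Al₂ Pl₂) Cl₂

  sumThrough-pointsOn : ∀ P (T : Fin (v Π) → Bool) → (∀ {Q} → T Q ≡ true → Q ≢ P) →
                        sumThrough P (λ l → pointsOn l T) ≡ count T
  sumThrough-pointsOn P T T∌P = begin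
    sumThrough P (λ l → pointsOn l T)      ≡⟨ sumF-cong incidences ⟩
    sumF (λ l → sumF (λ Q → flag l Q))     ≡⟨ sumF-comm flag ⟩
    sumF (λ Q → sumF (λ l → flag l Q))     ≡⟨ sumF-cong joiningLine ⟩
    sumF (λ Q → 𝟙 (T Q))                   ≡⟨ count≡sumF𝟙 T ⟨
    count T                                ∎
    where
    open ≡-Reasoning
    flag : Fin (b Π) → Fin (v Π) → ℕ
    flag l Q = 𝟙 (I Π P l ∧ (I Π Q l ∧ T Q))
    incidences : ∀ l → (if I Π P l then pointsOn l T else 0) ≡ sumF (flag l)
    incidences l with I Π P l
    ... | true  = count≡sumF𝟙 (λ Q → I Π Q l ∧ T Q)
    ... | false = sym (sumF-zero {f = λ (_ : Fin (v Π)) → 0} (λ _ → refl))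
    joiningLine : ∀ Q → sumF (λ l → flag l Q) ≡ 𝟙 (T Q)
    joiningLine Q with T Q in TQ
    ... | true  = begin
      sumF (λ l → 𝟙 (I Π P l ∧ (I Π Q l ∧ true))) ≡⟨ sumF-cong (λ l → cong (𝟙 ∘ (I Π P l ∧_)) (∧-identityʳ _)) ⟩
      sumF (λ l → 𝟙 (I Π P l ∧ I Π Q l))          ≡⟨ count≡sumF𝟙 (λ l → I Π P l ∧ I Π Q l) ⟨
      count (λ l → I Π P l ∧ I Π Q l)             ≡⟨ twoPoints Π P Q (≢-sym (T∌P TQ)) ⟩
      1                                           ∎
    ... | false = sumF-zero λ l →
      cong 𝟙 (trans (cong (I Π P l ∧_) (∧-zeroʳ (I Π Q l))) (∧-zeroʳ (I Π P l)))

  linesThrough-order : ∀ P → linesThrough P ≡ suc n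
  linesThrough-order P = begin
    linesThrough P                                  ≡⟨ count≡sumF𝟙 (I Π P) ⟩
    sumThrough P (λ _ → 1)                          ≡⟨ sumF-cong meetsOnce ⟩
    sumThrough P (λ l → pointsOn l (λ Q → I Π Q m)) ≡⟨ sumThrough-pointsOn P _ m∌P ⟩
    count (λ Q → I Π Q m)                           ≡⟨ order Π m ⟩
    suc n                                           ∎
    where
    open ≡-Reasoning
    m : Fin (b Π)
    m = proj₁ (lineAvoiding P)
    P∉m : I Π P m ≢ true
    P∉m Pm with () ← trans (sym Pm) (proj₂ (lineAvoiding P))
    m∌P : ∀ {Q} → I Π Q m ≡ true → Q ≢ P
    m∌P Qm refl = P∉m Qm
    meetsOnce : ∀ l → (if I Π P l then 1 else 0) ≡ (if I Π P l then pointsOn l (λ Q → I Π Q m) else 0)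
    meetsOnce l with I Π P l in Pl
    ... | true  = sym (twoLines Π l m (λ { refl → P∉m Pl }))
    ... | false = refl

  pointsOn≥2⇒2[1+n]≤count : ∀ P (T : Fin (v Π) → Bool) → (∀ {Q} → T Q ≡ true → Q ≢ P) →
                            (∀ {l} → I Π P l ≡ true → 2 ≤ pointsOn l T) → 2 * suc n ≤ count T
  pointsOn≥2⇒2[1+n]≤count P T T∌P 2≤ = begin
    2 * suc n                         ≡⟨ cong (2 *_) (linesThrough-order P) ⟨
    2 * linesThrough P                ≡⟨ sumF-if 2 (I Π P) ⟨
    sumThrough P (λ _ → 2)            ≤⟨ sumThrough-mono P 2≤ ⟩
    sumThrough P (λ l → pointsOn l T) ≡⟨ sumThrough-pointsOn P T T∌P ⟩
    count T                           ∎
    where open ≤-Reasoning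

module _ {n} (Π : ProjectivePlane n) {p} (c : Word Π p) (c∈C⊥ : InDualCode Π p c) where

  support : Fin (v Π) → Bool
  support Q = not (isZero (c Q))

  module _ {P} (cP≢0 : toℕ (c P) ≢ 0) {l} (Pl : I Π P l ≡ true) where

    private
      term : Fin (v Π) → ℕ
      term R = if I Π R l then toℕ (c R) else 0

      term-on : ∀ {R} → I Π R l ≡ true → term R ≡ toℕ (c R)
      term-on Rl rewrite Rl = refl

      term-vanishes : ∀ {R} → R ≢ P → (I Π R l ∧ (support ∖ P) R) ≡ false → term R ≡ 0
      term-vanishes {R} R≢P h with I Π R l
      ... | false = refl
      ... | true  = not-does≡false⇒ (toℕ (c R) ℕ.≟ 0) (trans (sym (∖-≢ support R≢P)) h)

    pointsOn-support≢0 : pointsOn Π l (support ∖ P) ≢ 0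
    pointsOn-support≢0 none = <⇒≢ (Finₚ.toℕ<n (c P))
      (n∣m⇒m≡n (n≢0⇒n>0 cP≢0) (<-≤-trans (Finₚ.toℕ<n (c P)) (m≤m+n p p)) (subst (p ∣_) lineSum (c∈C⊥ l)))
      where
      lineSum : sumF term ≡ toℕ (c P)
      lineSum = trans (sumF-single term P λ R R≢P → term-vanishes R≢P (count≡0⇒false none R)) (term-on Pl)

    pointsOn-support≡1⇒neg : pointsOn Π l (support ∖ P) ≡ 1 → ∃ λ Q → c Q ≡ neg (c P)
    pointsOn-support≡1⇒neg one with count≢0⇒∃ _ (λ c≡0 → 1+n≢0 (trans (sym one) c≡0))
    ... | Q , Q∈l∖P = Q , toℕ+toℕ≡p⇒neg (c P) (c Q)
      (n∣m⇒m≡n (<-≤-trans (n≢0⇒n>0 cP≢0) (m≤m+n _ _)) (+-mono-< (Finₚ.toℕ<n (c P)) (Finₚ.toℕ<n (c Q)))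
               (subst (p ∣_) lineSum (c∈C⊥ l)))
      where
      Q≢P : Q ≢ P
      Q≢P = proj₂ (∖-elim {f = support} (∧-conicalʳ (I Π Q l) _ Q∈l∖P))
      others : ∀ {R} → R ≢ Q → (I Π R l ∧ (support ∖ P) R) ≡ false
      others {R} R≢Q = ¬-not (λ R∈l∖P → R≢Q (count≡1⇒unique one Q∈l∖P R∈l∖P))
      lineSum : sumF term ≡ toℕ (c P) + toℕ (c Q)
      lineSum = trans (sumF-pair term (Q≢P ∘ sym) λ R R≢P R≢Q → term-vanishes R≢P (others R≢Q))
                      (cong₂ _+_ (term-on Pl) (term-on (∧-conicalˡ _ _ Q∈l∖P)))

  partner : weight {Π = Π} c ≤ 2 * suc n → ∀ {P} → toℕ (c P) ≢ 0 → ∃ λ Q → c Q ≡ neg (c P)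
  partner w≤2[1+n] {P} cP≢0
    with Finₚ.any? (λ l → (I Π P l Boolₚ.≟ true) ×-dec (pointsOn Π l (support ∖ P) ℕ.≟ 1))
  ... | yes (l , Pl , one) = pointsOn-support≡1⇒neg cP≢0 Pl one
  ... | no  noPair = ⊥-elim (<⇒≱ (s≤s w≤2[1+n]) (begin
    suc (2 * suc n)           ≤⟨ s≤s (pointsOn≥2⇒2[1+n]≤count Π P (support ∖ P) support∖P∌P atLeastTwo) ⟩
    suc (count (support ∖ P)) ≡⟨ count-∖ support (¬⇒not-does≡true (toℕ (c P) ℕ.≟ 0) cP≢0) ⟨
    weight {Π = Π} c          ∎))
    where
    open ≤-Reasoning
    support∖P∌P : ∀ {Q} → (support ∖ P) Q ≡ true → Q ≢ P
    support∖P∌P = proj₂ ∘ ∖-elim {f = support}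
    atLeastTwo : ∀ {l} → I Π P l ≡ true → 2 ≤ pointsOn Π l (support ∖ P)
    atLeastTwo {l} Pl with pointsOn Π l (support ∖ P) in k
    ... | 0           = ⊥-elim (pointsOn-support≢0 cP≢0 Pl k)
    ... | 1           = ⊥-elim (noPair (l , Pl , k))
    ... | suc (suc _) = s≤s (s≤s z≤n)

module _ {n} {Π : ProjectivePlane n} {p} (c : Word Π p) where

  occurs⇒∃ : ∀ {s} → occurs {Π = Π} c s ≡ true → ∃ λ P → c P ≡ s
  occurs⇒∃ {s} h =
    let P , cP≟s = count≢0⇒∃ _ (not-does≡true⇒¬ (_ ℕ.≟ 0) h) in P , does≡true⇒ (c P ≟ s) cP≟s

  occurs-at : ∀ P → occurs {Π = Π} c (c P) ≡ true
  occurs-at P = ¬⇒not-does≡true (_ ℕ.≟ 0) (true⇒count≢0 {f = λ Q → does (c Q ≟ c P)} (dec-true (c P ≟ c P) refl))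

  nSymbols-even : ¬ 2 ∣ p → (∀ {P} → toℕ (c P) ≢ 0 → ∃ λ Q → c Q ≡ neg (c P)) →
                  ∃ λ k → nSymbols {Π = Π} c ≡ 2 * k
  nSymbols-even p-odd negClosed = count-even (record
    { closed       = closed
    ; fixpointFree = λ {s} h → neg-fixpointFree p-odd s (proj₁ (elim h))
    ; involutive   = λ {s} _ → neg-involutive s
    })
    where
    Symbol : Fin p → Bool
    Symbol s = not (isZero s) ∧ occurs {Π = Π} c s
    elim : ∀ {s} → Symbol s ≡ true → toℕ s ≢ 0 × ∃ λ P → c P ≡ s
    elim {s} h = not-does≡true⇒¬ (toℕ s ℕ.≟ 0) (∧-conicalˡ _ (occurs {Π = Π} c s) h)
               , occurs⇒∃ (∧-conicalʳ (not (isZero s)) _ h)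
    closed : ∀ {s} → Symbol s ≡ true → Symbol (neg s) ≡ true
    closed {s} h with elim h
    ... | s≢0 , P , refl with negClosed s≢0
    ...   | Q , cQ≡-s = cong₂ _∧_ (¬⇒not-does≡true (_ ℕ.≟ 0) (toℕ-neg≢0 s s≢0))
                                  (subst (λ t → occurs {Π = Π} c t ≡ true) cQ≡-s (occurs-at Q))

weight-bound : ∀ {p} ε → 1 ≤ p → ε ≤ p ∸ 2 → 2 * (p * p) ∸ 2 * p + 2 + ε ≤ 2 * suc (p * p)
weight-bound {p} ε 1≤p ε≤p∸2 = begin
  2 * q ∸ 2 * p + 2 + ε       ≤⟨ +-monoʳ-≤ (2 * q ∸ 2 * p + 2) ε≤2p ⟩
  2 * q ∸ 2 * p + 2 + 2 * p   ≡⟨ +-assoc (2 * q ∸ 2 * p) 2 (2 * p) ⟩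
  2 * q ∸ 2 * p + (2 + 2 * p) ≡⟨ cong (2 * q ∸ 2 * p +_) (+-comm 2 (2 * p)) ⟩
  2 * q ∸ 2 * p + (2 * p + 2) ≡⟨ +-assoc (2 * q ∸ 2 * p) (2 * p) 2 ⟨
  2 * q ∸ 2 * p + 2 * p + 2   ≡⟨ cong (_+ 2) (m∸n+n≡m 2p≤2q) ⟩
  2 * q + 2                   ≡⟨ +-comm (2 * q) 2 ⟩
  2 + 2 * q                   ≡⟨ *-suc 2 q ⟨
  2 * suc q                   ∎
  where
  open ≤-Reasoning
  q : ℕ
  q = p * p
  ε≤2p : ε ≤ 2 * p
  ε≤2p = ≤-trans ε≤p∸2 (≤-trans (m∸n≤m p 2) (m≤m+n p (p + 0)))
  2p≤2q : 2 * p ≤ 2 * q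
  2p≤2q = *-monoʳ-≤ 2 (m≤m*n p p {{ℕ.>-nonZero 1≤p}})

mainTheorem14 : (p : ℕ) → Prime p → 3 ≤ p →
    (Π : ProjectivePlane (p * p)) → (c : Word Π p) → InDualCode Π p c →
    (ε : ℕ) → 1 ≤ ε → ε ≤ p ∸ 2 →
    weight {Π = Π} c ≡ 2 * (p * p) ∸ 2 * p + 2 + ε →
    ∃ λ k → nSymbols {Π = Π} c ≡ 2 * k
mainTheorem14 p p-prime 3≤p Π c c∈C⊥ ε _ ε≤p∸2 weight≡ =
  nSymbols-even {Π = Π} c (prime⇒odd p-prime 3≤p) (partner Π c c∈C⊥ weight≤2[1+q])
  where
  weight≤2[1+q] : weight {Π = Π} c ≤ 2 * suc (p * p)
  weight≤2[1+q] =
    subst (_≤ 2 * suc (p * p)) (sym weight≡) (weight-bound ε (≤-trans (s≤s z≤n) 3≤p) ε≤p∸2)
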